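{- For every shallow sequent $\Gamma$ and ordinals $\alpha,\gamma$: if $\mathsf{G_C}\vdash^{\alpha}_{\gamma}\Gamma$ then $\mathsf{D_C}\vdash^{\omega\cdot\alpha}_{\gamma}\Gamma$.
   Context: Fix $h\ge1$ agents. Formulas: $A::=p\mid\bar p\mid A\vee A\mid A\wedge A\mid\Diamond_iA\mid\Box_iA\mid\widetilde{\mathsf C}A\mid\mathsf CA$ ($1\le i\le h$), $\widetilde{\mathsf C}$ the De Morgan dual of $\mathsf C$; $\bar A$ by De Morgan laws. $\Box A:=\Box_1A\wedge\dots\wedge\Box_hA$, $\Diamond A:=\Diamond_1A\vee\dots\vee\Diamond_hA$, $\Box^k,\Diamond^k$ iterations. Rank: $rk(p)=rk(\bar p)=0$, $rk(A\wedge B)=rk(A\vee B)=\max(rk A,rk B)+1$, $rk(\Box_iA)=rk(\Diamond_iA)=rk(A)+1$, $rk(\mathsf CA)=rk(\widetilde{\mathsf C}A)=\omega+rk(A)$. A shallow sequent is a finite multiset of formulas; for a shallow sequent $\Gamma$, $\Diamond_i\Gamma$ and $\widetilde{\mathsf C}\Gamma$ prefix the connective to every element. System $\mathsf{G_C}$ (premises / conclusion): axiom $\Gamma,p,\bar p$; $\wedge$: $\Gamma,A$ and $\Gamma,B$ / $\Gamma,A\wedge B$; $\vee$: $\Gamma,A,B/\Gamma,A\vee B$; $\Box_i$: $\Gamma,\widetilde{\mathsf C}\Delta,A\,/\,\Diamond_i\Gamma,\widetilde{\mathsf C}\Delta,\Box_iA,\Sigma$; $\mathsf C$: premises $\Gamma,\Box^kA$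 for all $k\ge1$ / $\Gamma,\mathsf CA$; $\widetilde{\mathsf C}$: $\Gamma,\widetilde{\mathsf C}A,\Diamond A/\Gamma,\widetilde{\mathsf C}A$. Its cut: $\Gamma,A$ and $\Delta,\bar A$ / $\Gamma,\Delta$, of rank $rk(A)$. Nested sequents are finite multisets of formulas and boxed sequents $[\Delta]_i$ (so shallow sequents are nested sequents); contexts $\Gamma\{\ \}$ as usual. System $\mathsf{D_C}$: axiom $\Gamma\{p,\bar p\}$; $\wedge$: $\Gamma\{A\},\Gamma\{B\}/\Gamma\{A\wedge B\}$; $\vee$: $\Gamma\{A,B\}/\Gamma\{A\vee B\}$; $\Box_i$: $\Gamma\{[A]_i\}/\Gamma\{\Box_iA\}$; $\Diamond_i$: $\Gamma\{\Diamond_iA,[\Delta,A]_i\}/\Gamma\{\Diamond_iA,[\Delta]_i\}$; $\mathsf C$: premises $\Gamma\{\Box^kA\}$, all $k\ge1$ / $\Gamma\{\mathsf CA\}$; $\widetilde{\mathsf C}$: $\Gamma\{\widetilde{\mathsf C}A,\Diamond^kA\}/\Gamma\{\widetilde{\mathsf C}A\}$ (some $k\ge1$); its cut: $\Gamma\{A\},\Gamma\{\bar A\}/\Gamma\{\emptyset\}$, rank $rk(A)$. Proofs: well-founded, possibly infinitely branching trees with axiom leaves; depth = least ordinal greater than the depths of immediate subproofs. $\mathcal S\vdash^\alpha_\gamma\Gamma$: there is a proof of $\Gamma$ in $\mathcal S$ plus that system's cuts of rank $<\gamma$, of depth $\le\alpha$. -}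

module Defs where

open import Data.Nat using (ℕ; zero; suc; _⊔_; _<ᵇ_)
open import Data.Bool using (if_then_else_)
open import Data.Fin using (Fin; zero; suc)
open import Data.List using (List; []; _∷_; _++_; map)
open import Data.Product using (_×_; _,_; Σ)
open import Data.List.Relation.Binary.Permutation.Propositional using (_↭_)
open import Function using (_∘_)

data Brw : Set where
  oz : Brw
  os : Brw → Brw
  ol : (ℕ → Brw) → Brw

infix 4 _≤o_ _<o_
data _≤o_ : Brw → Brw → Set where
  z≤o   : ∀ {b} → oz ≤o b
  s≤o   : ∀ {a b} → a ≤o b → os a ≤o os b
  ≤lim  : ∀ {a f} (k : ℕ) → a ≤o f k → a ≤o ol f
  lim≤  : ∀ {f b} → (∀ k → f k ≤o b) → ol f ≤o b

_<o_ : Brw → Brw → Set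
a <o b = os a ≤o b

fromℕ : ℕ → Brw
fromℕ zero    = oz
fromℕ (suc n) = os (fromℕ n)

ω : Brw
ω = ol fromℕ

_⊕_ : Brw → Brw → Brw
a ⊕ oz    = a
a ⊕ os b  = os (a ⊕ b)
a ⊕ ol f  = ol (λ k → a ⊕ f k)

_⊙_ : Brw → Brw → Brw
a ⊙ oz   = oz
a ⊙ os b = (a ⊙ b) ⊕ a
a ⊙ ol f = ol (λ k → a ⊙ f k)

-- Formulas for h = suc n agents (agents are Fin (suc n)), atoms are ℕ

infixr 6 _∧_
infixr 5 _∨_

data Fm (n : ℕ) : Set where
  pos neg : ℕ → Fm n
  _∨_ _∧_ : Fm n → Fm n → Fm n
  dia box : Fin (suc n) → Fm n → Fm n
  Ct C : Fm n → Fm n          -- Ct = dual of C (written C-tilde)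

bar : ∀ {n} → Fm n → Fm n
bar (pos p)   = neg p
bar (neg p)   = pos p
bar (A ∨ B)   = bar A ∧ bar B
bar (A ∧ B)   = bar A ∨ bar B
bar (dia i A) = box i (bar A)
bar (box i A) = dia i (bar A)
bar (Ct A)    = C (bar A)
bar (C A)     = Ct (bar A)

bigAnd bigOr : ∀ {k} m → (Fin (suc m) → Fm k) → Fm k
bigAnd zero    f = f zero
bigAnd (suc m) f = f zero ∧ bigAnd m (f ∘ suc)
bigOr  zero    f = f zero
bigOr  (suc m) f = f zero ∨ bigOr m (f ∘ suc)

Box Dia : ∀ {n} → Fm n → Fm n
Box {n} A = bigAnd n (λ i → box i A)
Dia {n} A = bigOr  n (λ i → dia i A)

Boxᵏ Diaᵏ : ∀ {n} → ℕ → Fm n → Fm n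
Boxᵏ zero    A = A
Boxᵏ (suc k) A = Box (Boxᵏ k A)
Diaᵏ zero    A = A
Diaᵏ (suc k) A = Dia (Diaᵏ k A)

-- Rank: the pair (m , j) denotes the ordinal ω·m + j

maxR : ℕ × ℕ → ℕ × ℕ → ℕ × ℕ
maxR (m , j) (m' , j') =
  if m <ᵇ m' then (m' , j') else (if m' <ᵇ m then (m , j) else (m , j ⊔ j'))

sucR : ℕ × ℕ → ℕ × ℕ
sucR (m , j) = (m , suc j)

ωplusR : ℕ × ℕ → ℕ × ℕ      -- ω + (ω·m + j) = ω·(m+1) + j
ωplusR (m , j) = (suc m , j)

rkR : ∀ {n} → Fm n → ℕ × ℕ
rkR (pos p)   = (0 , 0)
rkR (neg p)   = (0 , 0)
rkR (A ∨ B)   = sucR (maxR (rkR A) (rkR B))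
rkR (A ∧ B)   = sucR (maxR (rkR A) (rkR B))
rkR (dia i A) = sucR (rkR A)
rkR (box i A) = sucR (rkR A)
rkR (Ct A)    = ωplusR (rkR A)
rkR (C A)     = ωplusR (rkR A)

rk : ∀ {n} → Fm n → Brw
rk A with rkR A
... | (m , j) = (ω ⊙ fromℕ m) ⊕ fromℕ j

-- System G_C (+ cuts of rank < γ):  G⊢ γ α Γ  means  G_C ⊢^α_γ Γ
-- Shallow sequents are lists taken up to permutation (multisets).

data G⊢ {n : ℕ} (γ : Brw) : Brw → List (Fm n) → Set where
  ax   : ∀ {α Γ' Γ p} → Γ' ↭ (Γ ++ pos p ∷ neg p ∷ []) → G⊢ γ α Γ'
  and  : ∀ {α β₁ β₂ Γ' Γ A B} → Γ' ↭ (Γ ++ (A ∧ B) ∷ []) →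
         β₁ <o α → G⊢ γ β₁ (Γ ++ A ∷ []) →
         β₂ <o α → G⊢ γ β₂ (Γ ++ B ∷ []) → G⊢ γ α Γ'
  or   : ∀ {α β Γ' Γ A B} → Γ' ↭ (Γ ++ (A ∨ B) ∷ []) →
         β <o α → G⊢ γ β (Γ ++ A ∷ B ∷ []) → G⊢ γ α Γ'
  boxR : ∀ {α β Γ' Γ Δ Σ' A} (i : Fin (suc n)) →
         Γ' ↭ (map (dia i) Γ ++ map Ct Δ ++ box i A ∷ Σ') →
         β <o α → G⊢ γ β (Γ ++ map Ct Δ ++ A ∷ []) → G⊢ γ α Γ'
  CR   : ∀ {α Γ' Γ A} → Γ' ↭ (Γ ++ C A ∷ []) → (β : ℕ → Brw) →
         (∀ k → β k <o α) → (∀ k → G⊢ γ (β k) (Γ ++ Boxᵏ (suc k) A ∷ [])) →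
         G⊢ γ α Γ'
  CtR  : ∀ {α β Γ' Γ A} → Γ' ↭ (Γ ++ Ct A ∷ []) →
         β <o α → G⊢ γ β (Γ ++ Ct A ∷ Dia A ∷ []) → G⊢ γ α Γ'
  cut  : ∀ {α β₁ β₂ Γ' Γ Δ} (A : Fm n) → Γ' ↭ (Γ ++ Δ) → rk A <o γ →
         β₁ <o α → G⊢ γ β₁ (Γ ++ A ∷ []) →
         β₂ <o α → G⊢ γ β₂ (Δ ++ bar A ∷ []) → G⊢ γ α Γ'

-- Nested sequents: lists of items taken up to (nested) permutation

data Item (n : ℕ) : Set where
  fm : Fm n → Item n
  bx : Fin (suc n) → List (Item n) → Item n

NSeq : ℕ → Set
NSeq n = List (Item n)

data _≋_ {n : ℕ} : NSeq n → NSeq n → Set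
data _≈ᵢ_ {n : ℕ} : Item n → Item n → Set

data _≈ᵢ_ {n} where
  fm≈ : ∀ {A} → fm A ≈ᵢ fm A
  bx≈ : ∀ {i Δ Δ'} → Δ ≋ Δ' → bx i Δ ≈ᵢ bx i Δ'

data _≋_ {n} where
  []≋   : [] ≋ []
  ∷≋    : ∀ {x y xs ys} → x ≈ᵢ y → xs ≋ ys → (x ∷ xs) ≋ (y ∷ ys)
  swap≋ : ∀ {x y xs} → (x ∷ y ∷ xs) ≋ (y ∷ x ∷ xs)
  trans≋ : ∀ {xs ys zs} → xs ≋ ys → ys ≋ zs → xs ≋ zs

data Ctx (n : ℕ) : Set where
  hole  : NSeq n → Ctx n
  inBox : NSeq n → Fin (suc n) → Ctx n → Ctx n

plug : ∀ {n} → Ctx n → NSeq n → NSeq n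
plug (hole Γ)      Δ = Γ ++ Δ
plug (inBox Γ i K) Δ = Γ ++ bx i (plug K Δ) ∷ []

-- System D_C (+ cuts of rank < γ):  D⊢ γ α Γ  means  D_C ⊢^α_γ Γ

data D⊢ {n : ℕ} (γ : Brw) : Brw → NSeq n → Set where
  ax   : ∀ {α Γ' p} (K : Ctx n) → Γ' ≋ plug K (fm (pos p) ∷ fm (neg p) ∷ []) →
         D⊢ γ α Γ'
  and  : ∀ {α β₁ β₂ Γ' A B} (K : Ctx n) → Γ' ≋ plug K (fm (A ∧ B) ∷ []) →
         β₁ <o α → D⊢ γ β₁ (plug K (fm A ∷ [])) →
         β₂ <o α → D⊢ γ β₂ (plug K (fm B ∷ [])) → D⊢ γ α Γ'
  or   : ∀ {α β Γ' A B} (K : Ctx n) → Γ' ≋ plug K (fm (A ∨ B) ∷ []) →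
         β <o α → D⊢ γ β (plug K (fm A ∷ fm B ∷ [])) → D⊢ γ α Γ'
  boxR : ∀ {α β Γ' A} (K : Ctx n) (i : Fin (suc n)) →
         Γ' ≋ plug K (fm (box i A) ∷ []) →
         β <o α → D⊢ γ β (plug K (bx i (fm A ∷ []) ∷ [])) → D⊢ γ α Γ'
  diaR : ∀ {α β Γ' A Δ} (K : Ctx n) (i : Fin (suc n)) →
         Γ' ≋ plug K (fm (dia i A) ∷ bx i Δ ∷ []) →
         β <o α → D⊢ γ β (plug K (fm (dia i A) ∷ bx i (Δ ++ fm A ∷ []) ∷ [])) →
         D⊢ γ α Γ'
  CR   : ∀ {α Γ' A} (K : Ctx n) → Γ' ≋ plug K (fm (C A) ∷ []) → (β : ℕ → Brw) →
         (∀ k → β k <o α) →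
         (∀ k → D⊢ γ (β k) (plug K (fm (Boxᵏ (suc k) A) ∷ []))) → D⊢ γ α Γ'
  CtR  : ∀ {α β Γ' A} (K : Ctx n) (k : ℕ) → Γ' ≋ plug K (fm (Ct A) ∷ []) →
         β <o α → D⊢ γ β (plug K (fm (Ct A) ∷ fm (Diaᵏ (suc k) A) ∷ [])) →
         D⊢ γ α Γ'
  cut  : ∀ {α β₁ β₂ Γ'} (K : Ctx n) (A : Fm n) → Γ' ≋ plug K [] → rk A <o γ →
         β₁ <o α → D⊢ γ β₁ (plug K (fm A ∷ [])) →
         β₂ <o α → D⊢ γ β₂ (plug K (fm (bar A) ∷ [])) → D⊢ γ α Γ'

shallow : ∀ {n} → List (Fm n) → NSeq n
shallow = map fm

-- Each G_C rule is simulated by finitely many D_C rules, which fits below ω·α. The Box_i rule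
-- becomes the nested box rule followed by one diamond rule per formula of Γ, moving Γ into the new
-- box. Its side formulas Ct Δ cannot be moved into the box, so the translation is proved for G_C
-- sequents whose Ct-formulas may sit anywhere on the path to the hole of a context (DropCt).
module Submission where

open import Data.Nat using (ℕ; zero; suc; _+_)
open import Data.Fin using (Fin; zero; suc)
open import Data.List using (List; []; _∷_; _++_; map; length)
open import Data.List.Properties using (++-assoc; ++-identityʳ; map-++)
open import Data.Product using (_×_; _,_; ∃)
open import Data.Sum using (_⊎_; inj₁; inj₂)
open import Data.List.Relation.Binary.Permutation.Propositional
  using (_↭_; refl; prep; swap; trans; ↭-sym; ↭-trans; ↭-reflexive)
import Data.List.Relation.Binary.Permutation.Propositional.Properties as ↭
open import Data.List.Membership.Propositional using (_∈_)
open import Data.List.Membership.Propositional.Properties using (∈-∃++; ∈-++⁺ˡ; ∈-++⁺ʳ)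
open import Data.List.Relation.Unary.Any using (here; there)
open import Relation.Binary.PropositionalEquality using (_≡_; refl; sym; cong; subst)
open import Function using (_∘_)
open import Defs

≤o-refl : ∀ {a} → a ≤o a
≤o-refl {oz}   = z≤o
≤o-refl {os a} = s≤o ≤o-refl
≤o-refl {ol f} = lim≤ (λ k → ≤lim k ≤o-refl)

≤o-trans : ∀ {a b c} → a ≤o b → b ≤o c → a ≤o c
≤o-trans p         (≤lim k q) = ≤lim k (≤o-trans p q)
≤o-trans z≤o       q          = z≤o
≤o-trans (lim≤ h)  q          = lim≤ (λ k → ≤o-trans (h k) q)
≤o-trans (s≤o p)   (s≤o q)    = s≤o (≤o-trans p q)
≤o-trans (≤lim k p) (lim≤ h)  = ≤o-trans p (h k)

≤o-suc : ∀ {a} → a ≤o os a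
≤o-suc {oz}   = z≤o
≤o-suc {os a} = s≤o ≤o-suc
≤o-suc {ol f} = lim≤ (λ k → ≤o-trans (≤o-suc {f k}) (s≤o (≤lim k ≤o-refl)))

<o⇒≤o : ∀ {a b} → a <o b → a ≤o b
<o⇒≤o = ≤o-trans ≤o-suc

⊕-fromℕ-monoˡ-≤o : ∀ {a b} k → a ≤o b → a ⊕ fromℕ k ≤o b ⊕ fromℕ k
⊕-fromℕ-monoˡ-≤o zero    p = p
⊕-fromℕ-monoˡ-≤o (suc k) p = s≤o (⊕-fromℕ-monoˡ-≤o k p)

ω⊙-mono-≤o : ∀ {a b} → a ≤o b → ω ⊙ a ≤o ω ⊙ b
ω⊙-mono-≤o z≤o       = z≤o
ω⊙-mono-≤o (s≤o p)   = lim≤ (λ k → ≤lim k (⊕-fromℕ-monoˡ-≤o k (ω⊙-mono-≤o p)))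
ω⊙-mono-≤o (≤lim k p) = ≤lim k (ω⊙-mono-≤o p)
ω⊙-mono-≤o (lim≤ h)  = lim≤ (λ k → ω⊙-mono-≤o (h k))

-- The room for translating one G_C step into finitely many D_C steps.
ω⊙β⊕n<ω⊙α : ∀ {β α} → β <o α → ∀ n → (ω ⊙ β) ⊕ fromℕ n <o ω ⊙ α
ω⊙β⊕n<ω⊙α p n = ≤o-trans (≤lim (suc n) ≤o-refl) (ω⊙-mono-≤o p)

⊕-fromℕ-+ : ∀ a m n → (a ⊕ fromℕ m) ⊕ fromℕ n ≡ a ⊕ fromℕ (n + m)
⊕-fromℕ-+ a m zero    = refl
⊕-fromℕ-+ a m (suc n) = cong os (⊕-fromℕ-+ a m n)

↭-shift-to-end : ∀ {a} {X : Set a} (P : List X) x Q → (P ++ x ∷ Q) ↭ ((P ++ Q) ++ x ∷ [])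
↭-shift-to-end P x Q = ↭-trans (↭.shift x P Q) (↭.∷↭∷ʳ x (P ++ Q))

module _ {n : ℕ} where

  ≋-refl : ∀ {xs : NSeq n} → xs ≋ xs
  ≈ᵢ-refl : ∀ {x : Item n} → x ≈ᵢ x
  ≋-refl {[]}     = []≋
  ≋-refl {x ∷ xs} = ∷≋ ≈ᵢ-refl ≋-refl
  ≈ᵢ-refl {fm A}     = fm≈
  ≈ᵢ-refl {bx i Δ}   = bx≈ ≋-refl

  ≋-sym : ∀ {xs ys : NSeq n} → xs ≋ ys → ys ≋ xs
  ≈ᵢ-sym : ∀ {x y : Item n} → x ≈ᵢ y → y ≈ᵢ x
  ≋-sym []≋          = []≋
  ≋-sym (∷≋ p q)     = ∷≋ (≈ᵢ-sym p) (≋-sym q)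
  ≋-sym swap≋        = swap≋
  ≋-sym (trans≋ p q) = trans≋ (≋-sym q) (≋-sym p)
  ≈ᵢ-sym fm≈      = fm≈
  ≈ᵢ-sym (bx≈ p)  = bx≈ (≋-sym p)

  infixr 5 _∙≋_
  _∙≋_ : ∀ {xs ys zs : NSeq n} → xs ≋ ys → ys ≋ zs → xs ≋ zs
  _∙≋_ = trans≋

  ≡⇒≋ : ∀ {xs ys : NSeq n} → xs ≡ ys → xs ≋ ys
  ≡⇒≋ refl = ≋-refl

  ↭⇒≋ : ∀ {xs ys : NSeq n} → xs ↭ ys → xs ≋ ys
  ↭⇒≋ refl         = ≋-refl
  ↭⇒≋ (prep x p)   = ∷≋ ≈ᵢ-refl (↭⇒≋ p)
  ↭⇒≋ (swap x y p) = swap≋ ∙≋ ∷≋ ≈ᵢ-refl (∷≋ ≈ᵢ-refl (↭⇒≋ p))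
  ↭⇒≋ (trans p q)  = ↭⇒≋ p ∙≋ ↭⇒≋ q

  ≋-++⁺ˡ : ∀ (zs : NSeq n) {xs ys} → xs ≋ ys → (zs ++ xs) ≋ (zs ++ ys)
  ≋-++⁺ˡ []       p = p
  ≋-++⁺ˡ (z ∷ zs) p = ∷≋ ≈ᵢ-refl (≋-++⁺ˡ zs p)

  plug-cong : ∀ (K : Ctx n) {xs ys} → xs ≋ ys → plug K xs ≋ plug K ys
  plug-cong (hole Γ)      p = ≋-++⁺ˡ Γ p
  plug-cong (inBox Γ i K) p = ≋-++⁺ˡ Γ (∷≋ (bx≈ (plug-cong K p)) []≋)

  ∈-resp-≋ : ∀ {F : Fm n} {xs ys} → fm F ∈ xs → xs ≋ ys → fm F ∈ ys
  ∈-resp-≋ (here refl)         (∷≋ fm≈ q)   = here refl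
  ∈-resp-≋ (there m)           (∷≋ p q)     = there (∈-resp-≋ m q)
  ∈-resp-≋ (here refl)         swap≋        = there (here refl)
  ∈-resp-≋ (there (here refl)) swap≋        = here refl
  ∈-resp-≋ (there (there m))   swap≋        = there (there m)
  ∈-resp-≋ m                   (trans≋ p q) = ∈-resp-≋ (∈-resp-≋ m p) q

  extend : Ctx n → NSeq n → Ctx n
  extend (hole Γ)      L = hole (Γ ++ L)
  extend (inBox Γ i K) L = inBox Γ i (extend K L)

  plug-extend : ∀ K L X → plug (extend K L) X ≡ plug K (L ++ X)
  plug-extend (hole Γ)      L X = ++-assoc Γ L X
  plug-extend (inBox Γ i K) L X = cong (λ Z → Γ ++ bx i Z ∷ []) (plug-extend K L X)

  extendBox : Ctx n → NSeq n → Fin (suc n) → Ctx n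
  extendBox (hole Γ)      L i = inBox (Γ ++ L) i (hole [])
  extendBox (inBox Γ j K) L i = inBox Γ j (extendBox K L i)

  plug-extendBox : ∀ K L i X → plug (extendBox K L i) X ≡ plug K (L ++ bx i X ∷ [])
  plug-extendBox (hole Γ)      L i X = ++-assoc Γ L _
  plug-extendBox (inBox Γ j K) L i X = cong (λ Z → Γ ++ bx j Z ∷ []) (plug-extendBox K L i X)

  infixr 9 _∘ᶜ_
  _∘ᶜ_ : Ctx n → Ctx n → Ctx n
  hole Γ      ∘ᶜ hole Δ      = hole (Γ ++ Δ)
  hole Γ      ∘ᶜ inBox Δ i L = inBox (Γ ++ Δ) i L
  inBox Γ i O ∘ᶜ L           = inBox Γ i (O ∘ᶜ L)

  plug-∘ᶜ : ∀ O L X → plug (O ∘ᶜ L) X ≡ plug O (plug L X)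
  plug-∘ᶜ (hole Γ)      (hole Δ)      X = ++-assoc Γ Δ X
  plug-∘ᶜ (hole Γ)      (inBox Δ i L) X = ++-assoc Γ Δ _
  plug-∘ᶜ (inBox Γ i O) L             X = cong (λ Z → Γ ++ bx i Z ∷ []) (plug-∘ᶜ O L X)

  topLevel : Ctx n → NSeq n
  topLevel (hole Γ)      = Γ
  topLevel (inBox Γ i K) = Γ

  belowTop : Ctx n → NSeq n → NSeq n
  belowTop (hole Γ)      Π = Π
  belowTop (inBox Γ i K) Π = bx i (plug K Π) ∷ []

  plug-topLevel : ∀ K Π → plug K Π ≡ topLevel K ++ belowTop K Π
  plug-topLevel (hole Γ)      Π = refl
  plug-topLevel (inBox Γ i K) Π = refl

  depth : Ctx n → ℕ
  depth (hole _)      = 0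
  depth (inBox _ _ K) = suc (depth K)

  OnPath : Ctx n → Fm n → Set
  OnPath (hole Γ)      F = fm F ∈ Γ
  OnPath (inBox Γ i K) F = fm F ∈ Γ ⊎ OnPath K F

  infix 4 _⊑_
  data _⊑_ : Ctx n → Ctx n → Set where
    hole⊑ : ∀ {Γ Γ'} J → Γ' ≋ (J ++ Γ) → hole Γ ⊑ hole Γ'
    box⊑  : ∀ {Γ Γ' i K K'} J → Γ' ≋ (J ++ Γ) → K ⊑ K' → inBox Γ i K ⊑ inBox Γ' i K'

  ⊑-refl : ∀ {K} → K ⊑ K
  ⊑-refl {hole Γ}      = hole⊑ [] ≋-refl
  ⊑-refl {inBox Γ i K} = box⊑ [] ≋-refl ⊑-refl

  onPath-⊑ : ∀ {K K' F} → OnPath K F → K ⊑ K' → OnPath K' F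
  onPath-⊑ m       (hole⊑ J e)      = ∈-resp-≋ (∈-++⁺ʳ J m) (≋-sym e)
  onPath-⊑ (inj₁ m) (box⊑ J e le)   = inj₁ (∈-resp-≋ (∈-++⁺ʳ J m) (≋-sym e))
  onPath-⊑ (inj₂ a) (box⊑ J e le)   = inj₂ (onPath-⊑ a le)

  onPath-extend : ∀ K L {F} → OnPath K F → OnPath (extend K L) F
  onPath-extend (hole Γ)      L m        = ∈-++⁺ˡ m
  onPath-extend (inBox Γ i K) L (inj₁ m) = inj₁ m
  onPath-extend (inBox Γ i K) L (inj₂ a) = inj₂ (onPath-extend K L a)

  onPath-extendBox : ∀ K L i {F} → OnPath K F → OnPath (extendBox K L i) F
  onPath-extendBox (hole Γ)      L i m        = inj₁ (∈-++⁺ˡ m)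
  onPath-extendBox (inBox Γ j K) L i (inj₁ m) = inj₁ m
  onPath-extendBox (inBox Γ j K) L i (inj₂ a) = inj₂ (onPath-extendBox K L i a)

  onPath-extendBox-new : ∀ K L i {F} → fm F ∈ L → OnPath (extendBox K L i) F
  onPath-extendBox-new (hole Γ)      L i m = inj₁ (∈-++⁺ʳ Γ m)
  onPath-extendBox-new (inBox Γ j K) L i m = inj₂ (onPath-extendBox-new K L i m)

bigOr-steps : ∀ m → Fin (suc m) → ℕ
bigOr-steps zero    _       = 0
bigOr-steps (suc m) zero    = 1
bigOr-steps (suc m) (suc j) = suc (bigOr-steps m j)

module _ {n : ℕ} {γ : Brw} where

  D⊢-resp-≋ : ∀ {α} {X Y : NSeq n} → D⊢ γ α X → X ≋ Y → D⊢ γ α Y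
  D⊢-resp-≋ (ax K e)                   q = ax K (≋-sym q ∙≋ e)
  D⊢-resp-≋ (and K e p₁ d₁ p₂ d₂)      q = and K (≋-sym q ∙≋ e) p₁ d₁ p₂ d₂
  D⊢-resp-≋ (or K e p d)               q = or K (≋-sym q ∙≋ e) p d
  D⊢-resp-≋ (boxR K i e p d)           q = boxR K i (≋-sym q ∙≋ e) p d
  D⊢-resp-≋ (diaR K i e p d)           q = diaR K i (≋-sym q ∙≋ e) p d
  D⊢-resp-≋ (CR K e β p d)             q = CR K (≋-sym q ∙≋ e) β p d
  D⊢-resp-≋ (CtR K k e p d)            q = CtR K k (≋-sym q ∙≋ e) p d
  D⊢-resp-≋ (cut K A e r p₁ d₁ p₂ d₂)  q = cut K A (≋-sym q ∙≋ e) r p₁ d₁ p₂ d₂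

  D⊢-mono : ∀ {α α'} {X : NSeq n} → D⊢ γ α X → α ≤o α' → D⊢ γ α' X
  D⊢-mono (ax K e)                  q = ax K e
  D⊢-mono (and K e p₁ d₁ p₂ d₂)     q = and K e (≤o-trans p₁ q) d₁ (≤o-trans p₂ q) d₂
  D⊢-mono (or K e p d)              q = or K e (≤o-trans p q) d
  D⊢-mono (boxR K i e p d)          q = boxR K i e (≤o-trans p q) d
  D⊢-mono (diaR K i e p d)          q = diaR K i e (≤o-trans p q) d
  D⊢-mono (CR K e β p d)            q = CR K e β (λ k → ≤o-trans (p k) q) d
  D⊢-mono (CtR K k e p d)           q = CtR K k e (≤o-trans p q) d
  D⊢-mono (cut K A e r p₁ d₁ p₂ d₂) q = cut K A e r (≤o-trans p₁ q) d₁ (≤o-trans p₂ q) d₂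

  plug-++-extend : ∀ (O : Ctx n) Θ X → plug O (X ++ Θ) ≋ plug (extend O Θ) X
  plug-++-extend O Θ X = plug-cong O (↭⇒≋ (↭.++-comm X Θ)) ∙≋ ≡⇒≋ (sym (plug-extend O Θ X))

  or-head : ∀ {δ} (O : Ctx n) Θ A B →
            D⊢ γ δ (plug O (fm A ∷ fm B ∷ Θ)) → D⊢ γ (os δ) (plug O (fm (A ∨ B) ∷ Θ))
  or-head O Θ A B d =
    or (extend O Θ) (plug-++-extend O Θ _) ≤o-refl (D⊢-resp-≋ d (plug-++-extend O Θ _))

  -- The premise must hold under any weakening J: the disjuncts passed over stay in the sequent.
  bigOr-intro : ∀ m (f : Fin (suc m) → Fm n) j (O : Ctx n) Θ δ →
                (∀ J → D⊢ γ δ (plug O (fm (f j) ∷ J ++ Θ))) →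
                D⊢ γ (δ ⊕ fromℕ (bigOr-steps m j)) (plug O (fm (bigOr m f) ∷ Θ))
  bigOr-intro zero    f zero    O Θ δ h = h []
  bigOr-intro (suc m) f zero    O Θ δ h = or-head O Θ _ _ (h (fm (bigOr m (f ∘ suc)) ∷ []))
  bigOr-intro (suc m) f (suc j) O Θ δ h =
    or-head O Θ _ _ (D⊢-resp-≋ (bigOr-intro m (f ∘ suc) j O (fm (f zero) ∷ Θ) δ h') (plug-cong O swap≋))
    where
    h' : ∀ J → D⊢ γ δ (plug O (fm (f (suc j)) ∷ J ++ fm (f zero) ∷ Θ))
    h' J = D⊢-resp-≋ (h (J ++ fm (f zero) ∷ [])) (plug-cong O (∷≋ fm≈ (≡⇒≋ (++-assoc J _ Θ))))

  diaR-all : ∀ (K : Ctx n) i Γ (Y : NSeq n) δ →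
    D⊢ γ δ (plug K (shallow (map (dia i) Γ) ++ bx i (Y ++ shallow Γ) ∷ [])) →
    D⊢ γ (δ ⊕ fromℕ (length Γ)) (plug K (shallow (map (dia i) Γ) ++ bx i Y ∷ []))
  diaR-all K i []       Y δ d = D⊢-resp-≋ d (plug-cong K (∷≋ (bx≈ (≡⇒≋ (++-identityʳ Y))) []≋))
  diaR-all K i (B ∷ Γ) Y δ d =
    diaR (extend K sΓ) i (shift-out _) ≤o-refl (D⊢-resp-≋ rec (≡⇒≋ (plug-extend K (dB ∷ []) _) ∙≋ shift-out _))
    where
    sΓ = shallow (map (dia i) Γ)
    dB = fm (dia i B)
    shift-out : ∀ Z → plug K (dB ∷ sΓ ++ Z) ≋ plug (extend K sΓ) (dB ∷ Z)
    shift-out Z = plug-cong K (↭⇒≋ (↭-sym (↭.shift dB sΓ Z))) ∙≋ ≡⇒≋ (sym (plug-extend K sΓ _))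
    reassoc : plug K (dB ∷ sΓ ++ bx i (Y ++ fm B ∷ shallow Γ) ∷ []) ≋
              plug (extend K (dB ∷ [])) (sΓ ++ bx i ((Y ++ fm B ∷ []) ++ shallow Γ) ∷ [])
    reassoc = plug-cong K (∷≋ fm≈ (≋-++⁺ˡ sΓ (∷≋ (bx≈ (≡⇒≋ (sym (++-assoc Y _ _)))) []≋)))
              ∙≋ ≡⇒≋ (sym (plug-extend K _ _))
    rec = diaR-all (extend K (dB ∷ [])) i Γ (Y ++ fm B ∷ []) δ (D⊢-resp-≋ d reassoc)

-- A formula Ct A on the path to the hole can be used in the hole: CtR adds Dia^(d+1) A at its
-- own level (d the depth of the hole below it), which the ∨- and diaR-rules carry down as Dia A.
module CtDescent {n : ℕ} {γ : Brw} (A : Fm n) where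

  -- Weakenings K' of K: the descent adds formulas to the levels it passes through.
  DiaPremise : Ctx n → Ctx n → NSeq n → Brw → Set
  DiaPremise O K Π β = ∀ K' → K ⊑ K' → D⊢ γ β (plug O (plug K' (Π ++ fm (Dia A) ∷ [])))

  descentSteps : Ctx n → ℕ
  descentSteps (hole _)      = 0
  descentSteps (inBox _ i K) = bigOr-steps n i + suc (descentSteps K)

  Diaᵏ-descend : ∀ K O Π β → DiaPremise O K Π β →
    D⊢ γ (β ⊕ fromℕ (descentSteps K)) (plug O (fm (Diaᵏ (suc (depth K)) A) ∷ plug K Π))
  Diaᵏ-descend (hole Γ) O Π β h =
    D⊢-resp-≋ (h (hole Γ) ⊑-refl)
      (plug-cong O (≡⇒≋ (sym (++-assoc Γ Π _)) ∙≋ ↭⇒≋ (↭-sym (↭.∷↭∷ʳ _ (Γ ++ Π)))))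
  Diaᵏ-descend (inBox Γ i K) O Π β h =
    subst (λ δ → D⊢ γ δ _) (⊕-fromℕ-+ β (suc (descentSteps K)) (bigOr-steps n i))
      (bigOr-intro n (λ j → dia j X) i O (Γ ++ bx i Δ ∷ []) (β ⊕ fromℕ (suc (descentSteps K)))
         (λ J → D⊢-resp-≋ (viaDiaR J) (plug-cong O (∷≋ fm≈ (≡⇒≋ (++-assoc J Γ _))))))
    where
    X = Diaᵏ (suc (depth K)) A
    Δ = plug K Π
    viaDiaR : ∀ J → D⊢ γ (β ⊕ fromℕ (suc (descentSteps K)))
                          (plug O (fm (dia i X) ∷ (J ++ Γ) ++ bx i Δ ∷ []))
    viaDiaR J = diaR (extend O (J ++ Γ)) i (shift-out _) ≤o-refl (D⊢-resp-≋ premise (shift-out _))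
      where
      shift-out : ∀ Z → plug O (fm (dia i X) ∷ (J ++ Γ) ++ Z) ≋ plug (extend O (J ++ Γ)) (fm (dia i X) ∷ Z)
      shift-out Z = plug-cong O (↭⇒≋ (↭-sym (↭.shift _ (J ++ Γ) Z))) ∙≋ ≡⇒≋ (sym (plug-extend O (J ++ Γ) _))
      L = inBox (fm (dia i X) ∷ J ++ Γ) i (hole [])
      h' : DiaPremise (O ∘ᶜ L) K Π β
      h' K' le = subst (D⊢ γ β) (sym (plug-∘ᶜ O L _)) (h (inBox _ i K') (box⊑ (fm (dia i X) ∷ J) ≋-refl le))
      premise : D⊢ γ (β ⊕ fromℕ (descentSteps K))
                     (plug O (fm (dia i X) ∷ (J ++ Γ) ++ bx i (Δ ++ fm X ∷ []) ∷ []))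
      premise = D⊢-resp-≋ (subst (D⊢ γ _) (plug-∘ᶜ O L _) (Diaᵏ-descend K (O ∘ᶜ L) Π β h'))
                  (plug-cong O (∷≋ fm≈ (≋-++⁺ˡ (J ++ Γ) (∷≋ (bx≈ (↭⇒≋ (↭.∷↭∷ʳ _ Δ))) []≋))))

  CtR-topLevel : ∀ K O Π β → fm (Ct A) ∈ topLevel K → DiaPremise O K Π β →
                 D⊢ γ (os (β ⊕ fromℕ (descentSteps K))) (plug O (plug K Π))
  CtR-topLevel K O Π β m h with ∈-∃++ m
  ... | ys , zs , eqt =
    CtR (extend O R) (depth K) (plug-cong O (↭⇒≋ Ct-last) ∙≋ ≡⇒≋ (sym (plug-extend O R (c ∷ []))))
      ≤o-refl (D⊢-resp-≋ (Diaᵏ-descend K O Π β h) (plug-cong O (↭⇒≋ Ct-Dia-last) ∙≋ ≡⇒≋ (sym (plug-extend O R _))))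
    where
    c = fm (Ct A)
    d = fm (Diaᵏ (suc (depth K)) A)
    R = ys ++ zs ++ belowTop K Π
    Ct-last : plug K Π ↭ R ++ c ∷ []
    Ct-last = ↭-trans (↭-reflexive (subst (λ T → plug K Π ≡ T ++ belowTop K Π) eqt (plug-topLevel K Π)))
                (↭-trans (↭-reflexive (++-assoc ys (c ∷ zs) _)) (↭-shift-to-end ys c _))
    Ct-Dia-last : d ∷ plug K Π ↭ R ++ c ∷ d ∷ []
    Ct-Dia-last = ↭-trans (prep d Ct-last) (↭-trans (↭.∷↭∷ʳ d _) (↭-reflexive (++-assoc R (c ∷ []) (d ∷ []))))

  CtR-onPath : ∀ K O Π β → OnPath K (Ct A) → DiaPremise O K Π β →
               ∃ λ N → D⊢ γ (β ⊕ fromℕ N) (plug O (plug K Π))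
  CtR-onPath (hole Γ)      O Π β m        h = _ , CtR-topLevel (hole Γ) O Π β m h
  CtR-onPath (inBox Γ i K) O Π β (inj₁ m) h = _ , CtR-topLevel (inBox Γ i K) O Π β m h
  CtR-onPath (inBox Γ i K) O Π β (inj₂ a) h =
    let N , d = CtR-onPath K (O ∘ᶜ L) Π β a h' in N , subst (D⊢ γ _) (plug-∘ᶜ O L _) d
    where
    L = inBox Γ i (hole [])
    h' : DiaPremise (O ∘ᶜ L) K Π β
    h' K' le = subst (D⊢ γ β) (sym (plug-∘ᶜ O L _)) (h (inBox Γ i K') (box⊑ [] ≋-refl le))

module _ {n : ℕ} where

  data DropCt (K : Ctx n) : List (Fm n) → List (Fm n) → Set where
    []   : DropCt K [] []
    keep : ∀ {x xs ys} → DropCt K xs ys → DropCt K (x ∷ xs) (x ∷ ys)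
    drop : ∀ {D xs ys} → OnPath K (Ct D) → DropCt K xs ys → DropCt K (Ct D ∷ xs) ys

  DropCt-refl : ∀ {K} xs → DropCt K xs xs
  DropCt-refl []       = []
  DropCt-refl (x ∷ xs) = keep (DropCt-refl xs)

  DropCt-++ : ∀ {K xs ys a b} → DropCt K xs a → DropCt K ys b → DropCt K (xs ++ ys) (a ++ b)
  DropCt-++ []          db = db
  DropCt-++ (keep da)   db = keep (DropCt-++ da db)
  DropCt-++ (drop m da) db = drop m (DropCt-++ da db)

  DropCt-++⁻ : ∀ {K} xs {ys zs} → DropCt K (xs ++ ys) zs →
               ∃ λ a → ∃ λ b → zs ≡ a ++ b × DropCt K xs a × DropCt K ys b
  DropCt-++⁻ []       d = [] , _ , refl , [] , d
  DropCt-++⁻ (x ∷ xs) (keep d) with DropCt-++⁻ xs d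
  ... | a , b , refl , da , db = x ∷ a , b , refl , keep da , db
  DropCt-++⁻ (x ∷ xs) (drop m d) with DropCt-++⁻ xs d
  ... | a , b , refl , da , db = a , b , refl , drop m da , db

  DropCt-map : ∀ {K K' xs ys} → (∀ {F} → OnPath K F → OnPath K' F) → DropCt K xs ys → DropCt K' xs ys
  DropCt-map f []         = []
  DropCt-map f (keep d)   = keep (DropCt-map f d)
  DropCt-map f (drop m d) = drop (f m) (DropCt-map f d)

  DropCt-↭ : ∀ {K xs ys xs'} → DropCt K xs ys → xs ↭ xs' → ∃ λ ys' → DropCt K xs' ys' × ys ↭ ys'
  DropCt-↭ d refl = _ , d , refl
  DropCt-↭ (keep d) (prep x p) with DropCt-↭ d p
  ... | _ , d' , q = _ , keep d' , prep x q
  DropCt-↭ (drop m d) (prep x p) with DropCt-↭ d p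
  ... | _ , d' , q = _ , drop m d' , q
  DropCt-↭ (keep (keep d)) (swap x y p) with DropCt-↭ d p
  ... | _ , d' , q = _ , keep (keep d') , swap x y q
  DropCt-↭ (keep (drop m d)) (swap x y p) with DropCt-↭ d p
  ... | _ , d' , q = _ , drop m (keep d') , prep x q
  DropCt-↭ (drop m (keep d)) (swap x y p) with DropCt-↭ d p
  ... | _ , d' , q = _ , keep (drop m d') , prep y q
  DropCt-↭ (drop m (drop m' d)) (swap x y p) with DropCt-↭ d p
  ... | _ , d' , q = _ , drop m' (drop m d') , q
  DropCt-↭ d (trans p₁ p₂) with DropCt-↭ d p₁
  ... | _ , d₁ , q₁ with DropCt-↭ d₁ p₂
  ... | _ , d₂ , q₂ = _ , d₂ , ↭-trans q₁ q₂

  DropCt-split-↭ : ∀ {K Γ' Γ₁} Γ Z → DropCt K Γ' Γ₁ → Γ' ↭ (Γ ++ Z) →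
                   ∃ λ a → ∃ λ b → DropCt K Γ a × DropCt K Z b × Γ₁ ↭ (a ++ b)
  DropCt-split-↭ Γ Z d p with DropCt-↭ d p
  ... | _ , d' , q with DropCt-++⁻ Γ d'
  ... | a , b , refl , da , db = a , b , da , db , q

  DropCt-map-dia : ∀ {K} i Γ {a} → DropCt K (map (dia i) Γ) a → a ≡ map (dia i) Γ
  DropCt-map-dia i []      []       = refl
  DropCt-map-dia i (B ∷ Γ) (keep d) = cong (dia i B ∷_) (DropCt-map-dia i Γ d)

  DropCt-all-Ct : ∀ {K K'} Δ {c} → DropCt K (map Ct Δ) c →
                  (∀ D → fm (Ct D) ∈ shallow c → OnPath K' (Ct D)) →
                  (∀ {F} → OnPath K F → OnPath K' F) → DropCt K' (map Ct Δ) []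
  DropCt-all-Ct []      []         inc mono = []
  DropCt-all-Ct (D ∷ Δ) (keep d)   inc mono =
    drop (inc D (here refl)) (DropCt-all-Ct Δ d (λ D' m → inc D' (there m)) mono)
  DropCt-all-Ct (D ∷ Δ) (drop m d) inc mono = drop (mono m) (DropCt-all-Ct Δ d inc mono)

  shallow-++ : ∀ (a b : List (Fm n)) → shallow (a ++ b) ≡ shallow a ++ shallow b
  shallow-++ = map-++ fm

  extend-extend : ∀ K (L M : NSeq n) → extend (extend K L) M ≡ extend K (L ++ M)
  extend-extend (hole Γ)      L M = cong hole (++-assoc Γ L M)
  extend-extend (inBox Γ i K) L M = cong (inBox Γ i) (extend-extend K L M)

  plug-extend-↭ : ∀ K {L M : NSeq n} X → L ↭ M → plug (extend K L) X ≋ plug (extend K M) X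
  plug-extend-↭ K {L} {M} X p =
    ≡⇒≋ (plug-extend K L X) ∙≋ plug-cong K (↭⇒≋ (↭.++⁺ʳ X p)) ∙≋ ≡⇒≋ (sym (plug-extend K M X))

  plug-extend-swap : ∀ K (P Q Z : NSeq n) → plug (extend K Q) (P ++ Z) ≋ plug (extend K (P ++ Q)) Z
  plug-extend-swap K P Q Z =
    ≡⇒≋ (plug-extend K Q _)
    ∙≋ plug-cong K (↭⇒≋ (↭-trans (↭-reflexive (sym (++-assoc Q P Z))) (↭.++⁺ʳ Z (↭.++-comm Q P))))
    ∙≋ ≡⇒≋ (sym (plug-extend K _ Z))

  plug-shallow-++ : ∀ K a b → plug K (shallow (a ++ b)) ≋ plug (extend K (shallow a)) (shallow b)
  plug-shallow-++ K a b = plug-cong K (≡⇒≋ (shallow-++ a b)) ∙≋ ≡⇒≋ (sym (plug-extend K _ _))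

  plug-shallow-↭ : ∀ K {Γ₁} a b → Γ₁ ↭ (a ++ b) → plug K (shallow Γ₁) ≋ plug (extend K (shallow a)) (shallow b)
  plug-shallow-↭ K a b p = plug-cong K (↭⇒≋ (↭.map⁺ fm p)) ∙≋ plug-shallow-++ K a b

module _ {n : ℕ} {γ : Brw} where

  record Translates (α : Brw) (Γ : List (Fm n)) : Set where
    field embed : ∀ K {Γ₁} → DropCt K Γ Γ₁ → D⊢ γ (ω ⊙ α) (plug K (shallow Γ₁))
  open Translates public

  translate-premise : ∀ {β K Γ a} Π → Translates β (Γ ++ Π) → DropCt K Γ a →
                      D⊢ γ (ω ⊙ β) (plug (extend K (shallow a)) (shallow Π))
  translate-premise {K = K} {a = a} Π ih da =
    D⊢-resp-≋ (ih .embed K (DropCt-++ da (DropCt-refl Π))) (plug-shallow-++ K a Π)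

  translate-ax : ∀ {α Γ' Γ p} → Γ' ↭ (Γ ++ pos p ∷ neg p ∷ []) → Translates α Γ'
  translate-ax {Γ = Γ} e .embed K dr with DropCt-split-↭ Γ _ dr e
  ... | a , _ , _ , keep (keep []) , q = ax (extend K (shallow a)) (plug-shallow-↭ K a _ q)

  translate-and : ∀ {α β₁ β₂ Γ' Γ A B} → Γ' ↭ (Γ ++ (A ∧ B) ∷ []) →
                  β₁ <o α → Translates β₁ (Γ ++ A ∷ []) →
                  β₂ <o α → Translates β₂ (Γ ++ B ∷ []) → Translates α Γ'
  translate-and {Γ = Γ} {A} {B} e p₁ ih₁ p₂ ih₂ .embed K dr with DropCt-split-↭ Γ _ dr e
  ... | a , _ , da , keep [] , q =
    and (extend K (shallow a)) (plug-shallow-↭ K a _ q)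
      (ω⊙β⊕n<ω⊙α p₁ 0) (translate-premise (A ∷ []) ih₁ da)
      (ω⊙β⊕n<ω⊙α p₂ 0) (translate-premise (B ∷ []) ih₂ da)

  translate-or : ∀ {α β Γ' Γ A B} → Γ' ↭ (Γ ++ (A ∨ B) ∷ []) →
                 β <o α → Translates β (Γ ++ A ∷ B ∷ []) → Translates α Γ'
  translate-or {Γ = Γ} {A} {B} e p ih .embed K dr with DropCt-split-↭ Γ _ dr e
  ... | a , _ , da , keep [] , q =
    or (extend K (shallow a)) (plug-shallow-↭ K a _ q)
      (ω⊙β⊕n<ω⊙α p 0) (translate-premise (A ∷ B ∷ []) ih da)

  translate-CR : ∀ {α Γ' Γ A} → Γ' ↭ (Γ ++ C A ∷ []) → (β : ℕ → Brw) → (∀ k → β k <o α) →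
                 (∀ k → Translates (β k) (Γ ++ Boxᵏ (suc k) A ∷ [])) → Translates α Γ'
  translate-CR {Γ = Γ} {A} e β p ih .embed K dr with DropCt-split-↭ Γ _ dr e
  ... | a , _ , da , keep [] , q =
    CR (extend K (shallow a)) (plug-shallow-↭ K a _ q) (λ k → ω ⊙ β k)
      (λ k → ω⊙β⊕n<ω⊙α (p k) 0) (λ k → translate-premise (Boxᵏ (suc k) A ∷ []) (ih k) da)

  translate-CtR : ∀ {α β Γ' Γ A} → Γ' ↭ (Γ ++ Ct A ∷ []) →
                  β <o α → Translates β (Γ ++ Ct A ∷ Dia A ∷ []) → Translates α Γ'
  translate-CtR {Γ = Γ} {A} e p ih .embed K dr with DropCt-split-↭ Γ _ dr e
  ... | a , _ , da , keep [] , q =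
    CtR (extend K (shallow a)) 0 (plug-shallow-↭ K a _ q)
      (ω⊙β⊕n<ω⊙α p 0) (translate-premise (Ct A ∷ Dia A ∷ []) ih da)
  ... | a , _ , da , drop m [] , q =
    let N , d = CtDescent.CtR-onPath A K (hole []) (shallow a) _ m premise
    in D⊢-resp-≋ (D⊢-mono d (<o⇒≤o (ω⊙β⊕n<ω⊙α p N)))
         (plug-cong K (↭⇒≋ (↭.map⁺ fm (↭-trans (↭-reflexive (sym (++-identityʳ a))) (↭-sym q)))))
    where
    premise : CtDescent.DiaPremise A (hole []) K (shallow a) _
    premise K' le =
      subst (D⊢ γ _) (cong (plug K') (shallow-++ a _))
        (ih .embed K'
          (DropCt-++ (DropCt-map (λ m' → onPath-⊑ m' le) da) (drop (onPath-⊑ m le) (keep []))))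

  translate-cut : ∀ {α β₁ β₂ Γ' Γ Δ} A → Γ' ↭ (Γ ++ Δ) → rk A <o γ →
                  β₁ <o α → Translates β₁ (Γ ++ A ∷ []) →
                  β₂ <o α → Translates β₂ (Δ ++ bar A ∷ []) → Translates α Γ'
  translate-cut {Γ = Γ} {Δ} A e r p₁ ih₁ p₂ ih₂ .embed K dr with DropCt-split-↭ Γ Δ dr e
  ... | a , b , da , db , q =
    cut (extend K sab) A (plug-shallow-↭ K (a ++ b) [] (↭-trans q (↭-reflexive (sym (++-identityʳ _))))) r
      (ω⊙β⊕n<ω⊙α p₁ 0) (D⊢-resp-≋ left (plug-extend-↭ K _ (↭-trans (↭.++-comm sb sa) sab↭)))
      (ω⊙β⊕n<ω⊙α p₂ 0) (D⊢-resp-≋ right (plug-extend-↭ K _ sab↭))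
    where
    sa = shallow a
    sb = shallow b
    sab = shallow (a ++ b)
    sab↭ : (sa ++ sb) ↭ sab
    sab↭ = ↭-reflexive (sym (shallow-++ a b))
    left : D⊢ γ _ (plug (extend K (sb ++ sa)) (fm A ∷ []))
    left = subst (λ K₀ → D⊢ γ _ (plug K₀ _)) (extend-extend K sb sa)
             (translate-premise (A ∷ []) ih₁ (DropCt-map (onPath-extend K sb) da))
    right : D⊢ γ _ (plug (extend K (sa ++ sb)) (fm (bar A) ∷ []))
    right = subst (λ K₀ → D⊢ γ _ (plug K₀ _)) (extend-extend K sa sb)
              (translate-premise (bar A ∷ []) ih₂ (DropCt-map (onPath-extend K sa) db))

  translate-boxR : ∀ {α β Γ' Γ Δ Σ' A} i → Γ' ↭ (map (dia i) Γ ++ map Ct Δ ++ box i A ∷ Σ') →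
                   β <o α → Translates β (Γ ++ map Ct Δ ++ A ∷ []) → Translates α Γ'
  translate-boxR {β = β} {Γ = Γ} {Δ} {Σ'} {A} i e p ih .embed K {Γ₁} dr
    with DropCt-split-↭ (map (dia i) Γ) (map Ct Δ ++ box i A ∷ Σ') dr e
  ... | a , b , da , db , q with DropCt-++⁻ (map Ct Δ) db | DropCt-map-dia i Γ da
  ... | c , _ , refl , dc , keep {ys = s} _ | refl =
    boxR (extend K L) i conclusion (ω⊙β⊕n<ω⊙α p (length Γ))
      (D⊢-resp-≋ (diaR-all (extend K sR) i Γ (fm A ∷ []) (ω ⊙ β) (D⊢-resp-≋ inBoxed unboxΓ))
                 (plug-extend-swap K sD sR _))
    where
    sD = shallow (map (dia i) Γ)
    sR = shallow (c ++ s)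
    L = sD ++ sR
    K' = extendBox K L i
    conclusion : plug K (shallow Γ₁) ≋ plug (extend K L) (fm (box i A) ∷ [])
    conclusion =
      plug-shallow-↭ K (map (dia i) Γ ++ c ++ s) (box i A ∷ [])
        (↭-trans q (↭-trans (↭.++⁺ˡ (map (dia i) Γ) (↭-shift-to-end c (box i A) s))
                               (↭-reflexive (sym (++-assoc (map (dia i) Γ) (c ++ s) _)))))
      ∙≋ plug-extend-↭ K _ (↭-reflexive (shallow-++ (map (dia i) Γ) (c ++ s)))
    -- The kept part c of Ct Δ now sits beside the new box; the dropped part was already on the path of K.
    dropΔ : DropCt K' (map Ct Δ) []
    dropΔ = DropCt-all-Ct Δ dc
              (λ D m → onPath-extendBox-new K L i (∈-++⁺ʳ sD (subst (fm (Ct D) ∈_) (sym (shallow-++ c s)) (∈-++⁺ˡ m))))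
              (onPath-extendBox K L i)
    inBoxed : D⊢ γ (ω ⊙ β) (plug K' (shallow (Γ ++ A ∷ [])))
    inBoxed = ih .embed K' (DropCt-++ (DropCt-refl Γ) (DropCt-++ dropΔ (keep [])))
    unboxΓ : plug K' (shallow (Γ ++ A ∷ [])) ≋ plug (extend K sR) (sD ++ bx i ((fm A ∷ []) ++ shallow Γ) ∷ [])
    unboxΓ = ≡⇒≋ (plug-extendBox K L i _)
             ∙≋ plug-cong K (≋-++⁺ˡ L (∷≋ (bx≈ (≡⇒≋ (shallow-++ Γ _) ∙≋ ↭⇒≋ (↭-sym (↭.∷↭∷ʳ _ _)))) []≋))
             ∙≋ ≡⇒≋ (sym (plug-extend K L _))
             ∙≋ ≋-sym (plug-extend-swap K sD sR _)

  translate : ∀ {α Γ} → G⊢ γ α Γ → Translates α Γ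
  translate (ax e)                  = translate-ax e
  translate (and e p₁ d₁ p₂ d₂)     = translate-and e p₁ (translate d₁) p₂ (translate d₂)
  translate (or e p d)              = translate-or e p (translate d)
  translate (boxR {Γ = Γ} {Δ} {Σ'} {A} i e p d) =
    translate-boxR {Γ = Γ} {Δ} {Σ'} {A} i e p (translate d)
  translate (CR e β p ds)           = translate-CR e β p (λ k → translate (ds k))
  translate (CtR e p d)             = translate-CtR e p (translate d)
  translate (cut A e r p₁ d₁ p₂ d₂) = translate-cut A e r p₁ (translate d₁) p₂ (translate d₂)

theorem3p12 : (n : ℕ) (Γ : List (Fm n)) (α γ : Brw) →
    G⊢ γ α Γ → D⊢ γ (ω ⊙ α) (shallow Γ)
theorem3p12 n Γ α γ d = translate d .embed (hole []) (DropCt-refl Γ)
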